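{- Let $G=(V,E)$ be a directed graph with source $s$, sink $t$, unit capacities $u\equiv 1$, and let $k$ be a nonnegative integer. Then every maximum $s$-$t$-flow $x$ (i.e., an $s$-$t$-flow maximizing $\sum_{P\in\mathcal{P}}x(P)$) is a maximum robust flow, i.e., it maximizes $\operatorname{val_r}$ over all $s$-$t$-flows.
   Context: Let $\mathcal{P}$ be the set of $s$-$t$-paths in $G$ and $\mathcal{S}=\{S\subseteq E : |S|=k\}$. An $s$-$t$-flow is a vector $x\in\mathbb{R}_+^{\mathcal{P}}$ with $\sum_{P: e\in P} x(P)\le u(e)$ for all $e\in E$. Its robust flow value is $\operatorname{val_r}(x)=\sum_{P\in\mathcal{P}}x(P)-\max_{S\in\mathcal{S}}\sum_{P\in\mathcal{P}: P\cap S\neq\emptyset}x(P)$.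
   Formalization: Every $s$-$t$-flow, both the given maximum flow and all flows it is compared with, takes rational values on paths instead of real ones. -}

module Defs where

open import Data.Nat using (ℕ; zero; suc)
open import Data.Fin using (Fin)
open import Data.Fin.Properties using () renaming (_≟_ to _≟ᶠ_)
open import Data.Fin.Subset using (Subset; ∣_∣)
open import Data.Fin.Subset.Properties using () renaming (_∈?_ to _∈ˢ?_)
open import Data.Bool using (Bool; true; false)
open import Data.Vec using (Vec; []; _∷_)
open import Data.List using (List; []; _∷_; map; concatMap; filter; allFin; upTo; foldr; any)
open import Data.List.Relation.Unary.Unique.Propositional using (Unique)
import Data.List.Relation.Unary.Unique.DecPropositional as UDec
open import Data.List.Relation.Unary.Any using (Any)
import Data.List.Relation.Unary.Any as Any
import Data.List.Membership.DecPropositional as MDec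
open import Data.Rational using (ℚ; 0ℚ; 1ℚ; _+_; _-_; _≤_; _⊔_)
open import Data.Product using (_×_; _,_)
open import Relation.Binary.PropositionalEquality using (_≡_)
open import Relation.Nullary using (Dec; yes; no; ¬_)
open import Relation.Nullary.Decidable using (_×-dec_; ⌊_⌋)
open import Relation.Unary using (Pred; Decidable)
open import Data.Nat.Properties using () renaming (_≟_ to _≟ℕ_)

record Digraph : Set where
  field
    n    : ℕ
    m    : ℕ
    tail : Fin m → Fin n
    head : Fin m → Fin n

module _ (G : Digraph) where
  open Digraph G
  open UDec (_≟ᶠ_ {n}) using (unique?)
  open MDec (_≟ᶠ_ {m}) using () renaming (_∈?_ to _∈ᴸ?_)

  data Walk : Fin n → Fin n → List (Fin m) → Set where
    [] : ∀ {v} → Walk v v []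
    _∷_ : ∀ {v w e P} → tail e ≡ v → Walk (head e) w P → Walk v w (e ∷ P)

  walk? : ∀ v w P → Dec (Walk v w P)
  walk? v w [] with v ≟ᶠ w
  ... | yes Relation.Binary.PropositionalEquality.refl = yes []
  ... | no v≢w = no λ { [] → v≢w Relation.Binary.PropositionalEquality.refl }
  walk? v w (e ∷ P) with tail e ≟ᶠ v | walk? (head e) w P
  ... | yes p | yes q = yes (p ∷ q)
  ... | no ¬p | _ = no λ { (p ∷ _) → ¬p p }
  ... | _ | no ¬q = no λ { (_ ∷ q) → ¬q q }

  IsPath : Fin n → Fin n → List (Fin m) → Set
  IsPath s t P = Walk s t P × Unique (s ∷ map head P)

  isPath? : ∀ s t P → Dec (IsPath s t P)
  isPath? s t P = walk? s t P ×-dec unique? (s ∷ map head P)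

  listsOfLength : ℕ → List (List (Fin m))
  listsOfLength zero = [] ∷ []
  listsOfLength (suc l) = concatMap (λ e → map (e ∷_) (listsOfLength l)) (allFin m)

  -- All edge lists of length ≤ n (each exactly once); every simple path is among them.
  candidates : List (List (Fin m))
  candidates = concatMap listsOfLength (upTo (suc n))

  paths : Fin n → Fin n → List (List (Fin m))
  paths s t = filter (isPath? s t) candidates

  allSubsets : (k : ℕ) → List (Subset k)
  allSubsets zero = [] ∷ []
  allSubsets (suc k) = concatMap (λ b → map (b ∷_) (allSubsets k)) (true ∷ false ∷ [])

  kSubsets : ℕ → List (Subset m)
  kSubsets k = filter (λ S → ∣ S ∣ ≟ℕ k) (allSubsets m)

  sumℚ : List ℚ → ℚ
  sumℚ = foldr _+_ 0ℚ

  -- A path-flow assigns a value to each edge list; only values on s-t-paths matter.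
  PathVec : Set
  PathVec = List (Fin m) → ℚ

  val : Fin n → Fin n → PathVec → ℚ
  val s t x = sumℚ (map x (paths s t))

  load : Fin n → Fin n → PathVec → Fin m → ℚ
  load s t x e = sumℚ (map x (filter (e ∈ᴸ?_) (paths s t)))

  IsUnitFlow : Fin n → Fin n → PathVec → Set
  IsUnitFlow s t x =
    (∀ P → IsPath s t P → 0ℚ ≤ x P) × (∀ e → load s t x e ≤ 1ℚ)

  hits? : (S : Subset m) → Decidable (λ (P : List (Fin m)) → Any (λ e → Data.Fin.Subset._∈_ e S) P)
  hits? S P = Any.any? (_∈ˢ? S) P

  hitValue : Fin n → Fin n → PathVec → Subset m → ℚ
  hitValue s t x S = sumℚ (map x (filter (hits? S) (paths s t)))

  -- max_{S ∈ 𝒮} hitValue (taken as 0 if 𝒮 = ∅, i.e. k > |E|; all hit values are ≥ 0)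
  maxHit : ℕ → Fin n → Fin n → PathVec → ℚ
  maxHit k s t x = foldr _⊔_ 0ℚ (map (hitValue s t x) (kSubsets k))

  valr : ℕ → Fin n → Fin n → PathVec → ℚ
  valr k s t x = val s t x - maxHit k s t x

  IsMaxFlow : Fin n → Fin n → PathVec → Set
  IsMaxFlow s t x = IsUnitFlow s t x × (∀ y → IsUnitFlow s t y → val s t y ≤ val s t x)

  IsMaxRobustFlow : ℕ → Fin n → Fin n → PathVec → Set
  IsMaxRobustFlow k s t x =
    IsUnitFlow s t x × (∀ y → IsUnitFlow s t y → valr k s t y ≤ valr k s t x)

{-# OPTIONS --safe #-}

-- With unit capacities the paths hit by any k edges carry at most k units, so a maximum
-- flow x keeps robust value at least max(val x − k, 0).  Conversely, a maximum flow has a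
-- saturated s-t cut C with |C| = val x (Ford–Fulkerson: an s-t path in the residual graph
-- would augment x, and the augmented edge flow decomposes back into a larger path flow).
-- Deleting k edges that include min(k, |C|) edges of C leaves only paths through the
-- remaining |C| ∸ k unit-capacity edges of C, so no flow y has robust value above |C| ∸ k.
-- When s = t the empty path carries unbounded flow, so there is no maximum flow at all.

module Submission where

open import Defs
open import Level using (0ℓ)
open import Function using (_∘_)
open import Data.Empty using (⊥-elim)
open import Data.Product using (∃; _×_; _,_; proj₁; proj₂)
open import Data.Sum using (_⊎_; inj₁; inj₂; [_,_]′)
open import Data.Bool using (true; false; if_then_else_)
open import Data.Nat as ℕ using (ℕ; zero; suc; _∸_; z≤n; s≤s)
import Data.Nat.Properties as ℕ
open import Data.Fin using (Fin; zero; suc; _↑ˡ_; _↑ʳ_; splitAt)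
open import Data.Fin.Properties using (splitAt-↑ˡ; splitAt-↑ʳ; any?; injective⇒≤) renaming (_≟_ to _≟ᶠ_)
open import Data.Fin.Subset using (Subset; ∣_∣; ∁; ⁅_⁆; _∪_; _─_; _⊂_; _⊃_)
  renaming (_∈_ to _∈ˢ_; _∉_ to _∉ˢ_)
open import Data.Fin.Subset.Properties
  using (x∈⁅x⁆; x∈⁅y⁆⇒x≡y; p⊆p∪q; x∈p∪q⁺; x∈p∪q⁻; x∉p⇒x∈∁p; x∈p⇒x∉∁p; x∈∁p⇒x∉p; ∣p∣≤n;
         x∈p∧x∉q⇒x∈p─q)
  renaming (_∈?_ to _∈ˢ?_)
open import Data.Fin.Subset.Induction using (Acc; acc; ⊂-wellFounded; ⊃-wellFounded)
import Data.Vec as Vec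
open import Data.Vec.Properties using (lookup∘tabulate; lookup⇒[]=; []=⇒lookup)
open import Data.List using (List; []; _∷_; _++_; map; foldr; filter; concatMap; tabulate; allFin; upTo; length; lookup)
open import Data.List.Properties using (≡-dec; length-map; filter-none)
open import Data.List.Relation.Unary.All as All using (All; []; _∷_)
open import Data.List.Relation.Unary.Any using (Any; here; there)
open import Data.List.Relation.Unary.AllPairs as AllPairs using ([]; _∷_)
open import Data.List.Relation.Unary.Unique.Propositional using (Unique)
open import Data.List.Relation.Unary.Unique.Propositional.Properties using (allFin⁺; upTo⁺; map⁻)
open import Data.List.Membership.Propositional using (_∈_; find)
open import Data.List.Membership.Propositional.Properties
  using (∈-allFin; ∈-upTo⁺; ∈-filter⁺; ∈-filter⁻; ∈-lookup; ∈-map⁺; ∈-concatMap⁺)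
import Data.List.Membership.DecPropositional as MDec
open import Data.Rational using (ℚ; 0ℚ; 1ℚ; _+_; _*_; _-_; -_; _≤_; _<_; _⊔_; nonNegative)
open import Data.Rational.Properties
open import Data.Rational.Solver using (module +-*-Solver)
open import Algebra.Bundles using (Ring)
open import Algebra.Properties.Semiring.Sum (Ring.semiring +-*-ring)
  using (sum; sum-syntax; sum-cong-≗; sum-replicate-zero; ∑-distrib-+; ∑-comm; *-distribˡ-sum; *-distribʳ-sum)
open import Relation.Binary.Bundles using (DecTotalOrder)
open import Data.List.Extrema (DecTotalOrder.totalOrder ≤-decTotalOrder)
  using (argmin; argmin-all; f[argmin]≤f[⊤]; f[argmin]≤f[xs])
open import Relation.Binary.Definitions using (DecidableEquality)
open import Relation.Binary.PropositionalEquality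
open import Relation.Nullary using (Dec; yes; no; ¬_; does)
open import Relation.Nullary.Decidable using (dec-true; ¬?; _×-dec_)
open import Relation.Unary using (Pred; Decidable)

open +-*-Solver using (solve; _:=_; _:+_; _:*_; _:-_; :-_; con)

-- Indicators and sums

0≤1 : 0ℚ ≤ 1ℚ
0≤1 = <⇒≤ (positive⁻¹ 1ℚ)

⟦_⟧ : ∀ {p} {P : Set p} → Dec P → ℚ
⟦ d ⟧ = if does d then 1ℚ else 0ℚ

0≤⟦⟧ : ∀ {p} {P : Set p} (d : Dec P) → 0ℚ ≤ ⟦ d ⟧
0≤⟦⟧ (yes _) = 0≤1
0≤⟦⟧ (no _)  = ≤-refl

⟦⟧-yes : ∀ {p} {P : Set p} (d : Dec P) → P → ⟦ d ⟧ ≡ 1ℚ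
⟦⟧-yes (yes _) _ = refl
⟦⟧-yes (no ¬p) p = ⊥-elim (¬p p)

⟦⟧-no : ∀ {p} {P : Set p} (d : Dec P) → ¬ P → ⟦ d ⟧ ≡ 0ℚ
⟦⟧-no (yes p) ¬p = ⊥-elim (¬p p)
⟦⟧-no (no _)  _  = refl

⟦⟧-⇔ : ∀ {p q} {P : Set p} {Q : Set q} (p? : Dec P) (q? : Dec Q) → (P → Q) → (Q → P) → ⟦ p? ⟧ ≡ ⟦ q? ⟧
⟦⟧-⇔ (yes _) (yes _) _   _   = refl
⟦⟧-⇔ (no _)  (no _)  _   _   = refl
⟦⟧-⇔ (yes p) (no ¬q) p⇒q _   = ⊥-elim (¬q (p⇒q p))
⟦⟧-⇔ (no ¬p) (yes q) _   q⇒p = ⊥-elim (¬p (q⇒p q))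

*-nonNeg : ∀ {p q} → 0ℚ ≤ p → 0ℚ ≤ q → 0ℚ ≤ p * q
*-nonNeg {p} {q} 0≤p 0≤q = subst (_≤ p * q) (*-zeroˡ q) (*-monoʳ-≤-nonNeg q {{nonNegative 0≤q}} 0≤p)

*⟦⟧≤ : ∀ {p} {P : Set p} (d : Dec P) {a b} → (P → a ≤ b) → 0ℚ ≤ b → a * ⟦ d ⟧ ≤ b
*⟦⟧≤ (yes p) {a} {b} a≤b _   = subst (_≤ b) (sym (*-identityʳ a)) (a≤b p)
*⟦⟧≤ (no _)  {a} {b} _   0≤b = subst (_≤ b) (sym (*-zeroʳ a)) 0≤b

0≤q-p : ∀ {p q} → p ≤ q → 0ℚ ≤ q - p
0≤q-p {p} {q} p≤q = subst (_≤ q - p) (+-inverseʳ p) (+-monoˡ-≤ (- p) p≤q)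

fromℕ : ℕ → ℚ
fromℕ zero    = 0ℚ
fromℕ (suc k) = 1ℚ + fromℕ k

fromℕ-+ : ∀ a b → fromℕ (a ℕ.+ b) ≡ fromℕ a + fromℕ b
fromℕ-+ zero    b = sym (+-identityˡ (fromℕ b))
fromℕ-+ (suc a) b = trans (cong (1ℚ +_) (fromℕ-+ a b)) (sym (+-assoc 1ℚ (fromℕ a) (fromℕ b)))

0≤fromℕ : ∀ a → 0ℚ ≤ fromℕ a
0≤fromℕ zero    = ≤-refl
0≤fromℕ (suc a) = +-mono-≤ 0≤1 (0≤fromℕ a)

∑-mono-≤ : ∀ {k} {f g : Fin k → ℚ} → (∀ i → f i ≤ g i) → ∑[ i < k ] f i ≤ ∑[ i < k ] g i
∑-mono-≤ {zero}  f≤g = ≤-refl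
∑-mono-≤ {suc k} f≤g = +-mono-≤ (f≤g zero) (∑-mono-≤ (f≤g ∘ suc))

∑-nonNeg : ∀ {k} {f : Fin k → ℚ} → (∀ i → 0ℚ ≤ f i) → 0ℚ ≤ ∑[ i < k ] f i
∑-nonNeg {k} {f} 0≤f = subst (_≤ sum f) (sum-replicate-zero k) (∑-mono-≤ 0≤f)

∑-single : ∀ {k} {f : Fin k → ℚ} → (∀ i → 0ℚ ≤ f i) → ∀ i → f i ≤ ∑[ j < k ] f j
∑-single {suc k} {f} 0≤f zero    = subst (_≤ sum f) (+-identityʳ (f zero)) (+-monoʳ-≤ (f zero) (∑-nonNeg (0≤f ∘ suc)))
∑-single {suc k} {f} 0≤f (suc i) =
  ≤-trans (∑-single (0≤f ∘ suc) i) (subst (_≤ sum f) (+-identityˡ (sum (f ∘ suc))) (+-monoˡ-≤ (sum (f ∘ suc)) (0≤f zero)))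

∑-↑ : ∀ a {b} (f : Fin (a ℕ.+ b) → ℚ) →
      ∑[ r < a ℕ.+ b ] f r ≡ ∑[ i < a ] f (i ↑ˡ b) + ∑[ j < b ] f (a ↑ʳ j)
∑-↑ zero    f = sym (+-identityˡ _)
∑-↑ (suc a) {b} f = trans (cong (f zero +_) (∑-↑ a (f ∘ suc)))
  (sym (+-assoc (f zero) (∑[ i < a ] f (suc i ↑ˡ b)) (∑[ j < b ] f (suc a ↑ʳ j))))

-- Unfolds like Defs.sumℚ ∘ map, so val and load are ∑ₗ-sums by definition.
∑ₗ : ∀ {a} {A : Set a} → List A → (A → ℚ) → ℚ
∑ₗ xs f = foldr _+_ 0ℚ (map f xs)

module _ {a} {A : Set a} where

  ∑ₗ-cong : ∀ xs {f g : A → ℚ} → (∀ {x} → x ∈ xs → f x ≡ g x) → ∑ₗ xs f ≡ ∑ₗ xs g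
  ∑ₗ-cong []       f≡g = refl
  ∑ₗ-cong (x ∷ xs) f≡g = cong₂ _+_ (f≡g (here refl)) (∑ₗ-cong xs (f≡g ∘ there))

  ∑ₗ-mono-≤ : ∀ xs {f g : A → ℚ} → (∀ {x} → x ∈ xs → f x ≤ g x) → ∑ₗ xs f ≤ ∑ₗ xs g
  ∑ₗ-mono-≤ []       f≤g = ≤-refl
  ∑ₗ-mono-≤ (x ∷ xs) f≤g = +-mono-≤ (f≤g (here refl)) (∑ₗ-mono-≤ xs (f≤g ∘ there))

  ∑ₗ-zero : ∀ xs → ∑ₗ xs (λ (_ : A) → 0ℚ) ≡ 0ℚ
  ∑ₗ-zero []       = refl
  ∑ₗ-zero (x ∷ xs) = trans (+-identityˡ _) (∑ₗ-zero xs)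

  ∑ₗ-nonNeg : ∀ xs {f : A → ℚ} → (∀ {x} → x ∈ xs → 0ℚ ≤ f x) → 0ℚ ≤ ∑ₗ xs f
  ∑ₗ-nonNeg xs {f} 0≤f = subst (_≤ ∑ₗ xs f) (∑ₗ-zero xs) (∑ₗ-mono-≤ xs 0≤f)

  ∑ₗ-distrib-+ : ∀ xs (f g : A → ℚ) → ∑ₗ xs (λ x → f x + g x) ≡ ∑ₗ xs f + ∑ₗ xs g
  ∑ₗ-distrib-+ []       f g = sym (+-identityˡ 0ℚ)
  ∑ₗ-distrib-+ (x ∷ xs) f g = trans (cong (f x + g x +_) (∑ₗ-distrib-+ xs f g))
    (solve 4 (λ a b c d → (a :+ b) :+ (c :+ d) := (a :+ c) :+ (b :+ d)) refl (f x) (g x) _ _)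

  *-distribˡ-∑ₗ : ∀ c xs (f : A → ℚ) → c * ∑ₗ xs f ≡ ∑ₗ xs (λ x → c * f x)
  *-distribˡ-∑ₗ c []       f = *-zeroʳ c
  *-distribˡ-∑ₗ c (x ∷ xs) f = trans (*-distribˡ-+ c (f x) _) (cong (c * f x +_) (*-distribˡ-∑ₗ c xs f))

  *-distribʳ-∑ₗ : ∀ c xs (f : A → ℚ) → ∑ₗ xs f * c ≡ ∑ₗ xs (λ x → f x * c)
  *-distribʳ-∑ₗ c xs f = trans (*-comm _ c) (trans (*-distribˡ-∑ₗ c xs f) (∑ₗ-cong xs (λ _ → *-comm c _)))

  ∑ₗ-filter : ∀ {p} {P : Pred A p} (P? : Decidable P) xs (f : A → ℚ) →
              ∑ₗ (filter P? xs) f ≡ ∑ₗ xs (λ x → ⟦ P? x ⟧ * f x)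
  ∑ₗ-filter P? []       f = refl
  ∑ₗ-filter P? (x ∷ xs) f with P? x
  ... | yes _ = cong₂ _+_ (sym (*-identityˡ (f x))) (∑ₗ-filter P? xs f)
  ... | no _  = trans (∑ₗ-filter P? xs f) (sym (trans (cong (_+ _) (*-zeroˡ (f x))) (+-identityˡ _)))

  ∑ₗ-partition : ∀ {p} {P : Pred A p} (P? : Decidable P) xs (f : A → ℚ) →
                 ∑ₗ xs f ≡ ∑ₗ (filter P? xs) f + ∑ₗ (filter (¬? ∘ P?) xs) f
  ∑ₗ-partition P? []       f = sym (+-identityˡ 0ℚ)
  ∑ₗ-partition P? (x ∷ xs) f with P? x
  ... | yes _ = trans (cong (f x +_) (∑ₗ-partition P? xs f)) (sym (+-assoc (f x) _ _))
  ... | no _  = trans (cong (f x +_) (∑ₗ-partition P? xs f))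
                      (solve 3 (λ a b c → a :+ (b :+ c) := b :+ (a :+ c)) refl
                               (f x) (∑ₗ (filter P? xs) f) (∑ₗ (filter (¬? ∘ P?) xs) f))

  ∑ₗ-comm-∑ : ∀ xs {k} (f : A → Fin k → ℚ) → ∑ₗ xs (λ x → ∑[ i < k ] f x i) ≡ ∑[ i < k ] ∑ₗ xs (λ x → f x i)
  ∑ₗ-comm-∑ []       {k} f = sym (sum-replicate-zero k)
  ∑ₗ-comm-∑ (x ∷ xs) {k} f = trans (cong (∑[ i < k ] f x i +_) (∑ₗ-comm-∑ xs f))
    (sym (∑-distrib-+ (f x) (λ i → ∑ₗ xs (λ y → f y i))))

module _ {a b} {A : Set a} {B : Set b} where

  ∑ₗ-concatMap : ∀ (g : A → List B) xs (f : B → ℚ) → ∑ₗ (concatMap g xs) f ≡ ∑ₗ xs (λ x → ∑ₗ (g x) f)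
  ∑ₗ-concatMap g []       f = refl
  ∑ₗ-concatMap g (x ∷ xs) f = trans (∑ₗ-++ (g x)) (cong (∑ₗ (g x) f +_) (∑ₗ-concatMap g xs f))
    where
    ∑ₗ-++ : ∀ ys {zs} → ∑ₗ (ys ++ zs) f ≡ ∑ₗ ys f + ∑ₗ zs f
    ∑ₗ-++ []       = sym (+-identityˡ _)
    ∑ₗ-++ (y ∷ ys) {zs} = trans (cong (f y +_) (∑ₗ-++ ys)) (sym (+-assoc (f y) (∑ₗ ys f) (∑ₗ zs f)))

  ∑ₗ-map : ∀ (g : A → B) xs (f : B → ℚ) → ∑ₗ (map g xs) f ≡ ∑ₗ xs (f ∘ g)
  ∑ₗ-map g []       f = refl
  ∑ₗ-map g (x ∷ xs) f = cong (f (g x) +_) (∑ₗ-map g xs f)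

∑ₗ-tabulate : ∀ {a} {A : Set a} {k} (g : Fin k → A) (f : A → ℚ) → ∑ₗ (tabulate g) f ≡ ∑[ i < k ] f (g i)
∑ₗ-tabulate {k = zero}  g f = refl
∑ₗ-tabulate {k = suc k} g f = cong (f (g zero) +_) (∑ₗ-tabulate (g ∘ suc) f)

module _ {A : Set} (_≟_ : DecidableEquality A) where

  ∑ₗ-δ : ∀ xs x (f : A → ℚ) → ∑ₗ xs (λ y → ⟦ x ≟ y ⟧ * f y) ≡ ∑ₗ xs (λ y → ⟦ x ≟ y ⟧) * f x
  ∑ₗ-δ xs x f = trans (∑ₗ-cong xs pointwise) (sym (*-distribʳ-∑ₗ (f x) xs _))
    where
    pointwise : ∀ {y} → y ∈ xs → ⟦ x ≟ y ⟧ * f y ≡ ⟦ x ≟ y ⟧ * f x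
    pointwise {y} _ with x ≟ y
    ... | yes refl = refl
    ... | no _     = trans (*-zeroˡ (f y)) (sym (*-zeroˡ (f x)))

  count-unique : ∀ {xs x} → Unique xs → x ∈ xs → ∑ₗ xs (λ y → ⟦ x ≟ y ⟧) ≡ 1ℚ
  count-unique {y ∷ ys} (y∉ys ∷ _) (here refl) =
    trans (cong₂ _+_ (⟦⟧-yes (y ≟ y) refl) (trans (∑ₗ-cong ys absent) (∑ₗ-zero ys))) (+-identityʳ 1ℚ)
    where
    absent : ∀ {z} → z ∈ ys → ⟦ y ≟ z ⟧ ≡ 0ℚ
    absent z∈ys = ⟦⟧-no (y ≟ _) (All.lookup y∉ys z∈ys)
  count-unique {y ∷ ys} {x} (y∉ys ∷ u) (there x∈ys) =
    trans (cong (_+ _) (⟦⟧-no (x ≟ y) (All.lookup y∉ys x∈ys ∘ sym))) (trans (+-identityˡ _) (count-unique u x∈ys))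

δ : ∀ {k} → Fin k → Fin k → ℚ
δ i j = ⟦ i ≟ᶠ j ⟧

∑-δ : ∀ {k} (i : Fin k) (f : Fin k → ℚ) → ∑[ j < k ] (δ i j * f j) ≡ f i
∑-δ {k} i f = begin
  ∑[ j < k ] (δ i j * f j)            ≡⟨ sym (∑ₗ-tabulate (λ j → j) (λ j → δ i j * f j)) ⟩
  ∑ₗ (allFin k) (λ j → δ i j * f j) ≡⟨ ∑ₗ-δ _≟ᶠ_ (allFin k) i f ⟩
  ∑ₗ (allFin k) (δ i) * f i         ≡⟨ cong (_* f i) (count-unique _≟ᶠ_ (allFin⁺ k) (∈-allFin i)) ⟩
  1ℚ * f i                          ≡⟨ *-identityˡ (f i) ⟩
  f i                               ∎
  where open ≡-Reasoning

module _ {a} {A : Set a} (h : A → ℚ) where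

  ≤-foldr-⊔ : ∀ {xs x} → x ∈ xs → h x ≤ foldr _⊔_ 0ℚ (map h xs)
  ≤-foldr-⊔ {y ∷ _} (here refl) = p≤p⊔q (h y) _
  ≤-foldr-⊔ {y ∷ _} (there x∈) = ≤-trans (≤-foldr-⊔ x∈) (p≤q⊔p (h y) _)

  foldr-⊔-≤ : ∀ {xs b} → 0ℚ ≤ b → (∀ {x} → x ∈ xs → h x ≤ b) → foldr _⊔_ 0ℚ (map h xs) ≤ b
  foldr-⊔-≤ {[]}    0≤b _   = 0≤b
  foldr-⊔-≤ {_ ∷ _} 0≤b h≤b = ⊔-lub (h≤b (here refl)) (foldr-⊔-≤ 0≤b (h≤b ∘ there))

-- Lists and subsets of Fin

_∈ₗ?_ : ∀ {k} (e : Fin k) (P : List (Fin k)) → Dec (e ∈ P)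
_∈ₗ?_ = MDec._∈?_ _≟ᶠ_

⟦∈∷⟧ : ∀ {k} {e₀ : Fin k} {P} → All (e₀ ≢_) P → ∀ e → ⟦ e ∈ₗ? (e₀ ∷ P) ⟧ ≡ δ e₀ e + ⟦ e ∈ₗ? P ⟧
⟦∈∷⟧ {e₀ = e₀} {P} e₀∉P e with e₀ ≟ᶠ e
... | yes refl = begin
  ⟦ e₀ ∈ₗ? (e₀ ∷ P) ⟧ ≡⟨ ⟦⟧-yes (e₀ ∈ₗ? (e₀ ∷ P)) (here refl) ⟩
  1ℚ                  ≡⟨ sym (+-identityʳ 1ℚ) ⟩
  1ℚ + 0ℚ             ≡⟨ cong (1ℚ +_) (sym (⟦⟧-no (e₀ ∈ₗ? P) (λ e₀∈P → All.lookup e₀∉P e₀∈P refl))) ⟩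
  1ℚ + ⟦ e₀ ∈ₗ? P ⟧   ∎
  where open ≡-Reasoning
... | no e₀≢e = trans (⟦⟧-⇔ (e ∈ₗ? (e₀ ∷ P)) (e ∈ₗ? P) drop-head there) (sym (+-identityˡ _))
  where
  drop-head : e ∈ e₀ ∷ P → e ∈ P
  drop-head (here e≡e₀) = ⊥-elim (e₀≢e (sym e≡e₀))
  drop-head (there e∈P) = e∈P

lookup-injective : ∀ {a} {A : Set a} {xs : List A} → Unique xs → ∀ {i j} → lookup xs i ≡ lookup xs j → i ≡ j
lookup-injective {xs = _ ∷ _} (_   ∷ _) {zero}  {zero}  _  = refl
lookup-injective {xs = _ ∷ _} (x∉ ∷ _) {zero}  {suc j} eq = ⊥-elim (All.lookup x∉ (∈-lookup j) eq)
lookup-injective {xs = _ ∷ _} (x∉ ∷ _) {suc i} {zero}  eq = ⊥-elim (All.lookup x∉ (∈-lookup i) (sym eq))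
lookup-injective {xs = _ ∷ _} (_   ∷ u) {suc i} {suc j} eq = cong suc (lookup-injective u eq)

unique-length≤ : ∀ {k} {xs : List (Fin k)} → Unique xs → length xs ℕ.≤ k
unique-length≤ u = injective⇒≤ (lookup-injective u)

_≟ₚ_ : ∀ {k} → DecidableEquality (List (Fin k))
_≟ₚ_ = ≡-dec _≟ᶠ_

⟦∷≟∷⟧ : ∀ {k} (e′ e : Fin k) P Q → ⟦ (e′ ∷ P) ≟ₚ (e ∷ Q) ⟧ ≡ δ e′ e * ⟦ P ≟ₚ Q ⟧
⟦∷≟∷⟧ e′ e P Q with e′ ≟ᶠ e
... | yes _ = sym (*-identityˡ ⟦ P ≟ₚ Q ⟧)
... | no _  = sym (*-zeroˡ ⟦ P ≟ₚ Q ⟧)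

subsetOf : ∀ {k p} {P : Pred (Fin k) p} → Decidable P → Subset k
subsetOf P? = Vec.tabulate (does ∘ P?)

module _ {k p} {P : Pred (Fin k) p} (P? : Decidable P) where

  ∈-subsetOf⁺ : ∀ {e} → P e → e ∈ˢ subsetOf P?
  ∈-subsetOf⁺ {e} Pe = lookup⇒[]= e (subsetOf P?) (trans (lookup∘tabulate (does ∘ P?) e) (dec-true (P? e) Pe))

  ∈-subsetOf⁻ : ∀ {e} → e ∈ˢ subsetOf P? → P e
  ∈-subsetOf⁻ {e} e∈ with P? e | trans (sym (lookup∘tabulate (does ∘ P?) e)) ([]=⇒lookup e∈)
  ... | yes Pe | _  = Pe
  ... | no _   | ()

∑-⟦∈⟧ : ∀ {k} (S : Subset k) → ∑[ e < k ] ⟦ e ∈ˢ? S ⟧ ≡ fromℕ ∣ S ∣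
∑-⟦∈⟧ Vec.[]          = refl
∑-⟦∈⟧ (true  Vec.∷ S) = cong (1ℚ +_) (∑-⟦∈⟧ S)
∑-⟦∈⟧ (false Vec.∷ S) = trans (+-identityˡ _) (∑-⟦∈⟧ S)

choose : ∀ {k} (C : Subset k) j → j ℕ.≤ k → ∃ λ S → ∣ S ∣ ≡ j × ∣ C ─ S ∣ ≡ ∣ C ∣ ∸ j
choose Vec.[] zero _ = Vec.[] , refl , refl
choose (true Vec.∷ C) (suc j) (s≤s j≤k) =
  let S , ∣S∣≡j , ∣C─S∣ = choose C j j≤k in true Vec.∷ S , cong suc ∣S∣≡j , ∣C─S∣
choose (true Vec.∷ C) zero _ =
  let S , ∣S∣≡0 , ∣C─S∣ = choose C zero z≤n in false Vec.∷ S , ∣S∣≡0 , cong suc ∣C─S∣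
choose {suc k} (false Vec.∷ C) j j≤1+k with ℕ.m≤n⇒m<n∨m≡n j≤1+k
... | inj₁ (s≤s j≤k) =
  let S , ∣S∣≡j , ∣C─S∣ = choose C j j≤k in false Vec.∷ S , ∣S∣≡j , ∣C─S∣
... | inj₂ refl =
  let S , ∣S∣≡k , ∣C─S∣ = choose C k ℕ.≤-refl in
  true Vec.∷ S , cong suc ∣S∣≡k , trans ∣C─S∣ (trans C∸k≡0 (sym C∸1+k≡0))
  where
  C∸k≡0 : ∣ C ∣ ∸ k ≡ 0
  C∸k≡0 = ℕ.m≤n⇒m∸n≡0 (∣p∣≤n C)
  C∸1+k≡0 : ∣ C ∣ ∸ suc k ≡ 0
  C∸1+k≡0 = ℕ.m≤n⇒m∸n≡0 (ℕ.m≤n⇒m≤1+n (∣p∣≤n C))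

-- Net flow and cuts

module _ (H : Digraph) where
  open Digraph H

  incidence : Fin m → Fin n → ℚ
  incidence e v = δ (tail e) v - δ (head e) v

  netOut : (Fin m → ℚ) → Fin n → ℚ
  netOut h v = ∑[ e < m ] (h e * incidence e v)

  trail-netOut : ∀ {u w P} → Walk H u w P → Unique P → ∀ v →
                 ∑[ e < m ] (⟦ e ∈ₗ? P ⟧ * incidence e v) ≡ δ u v - δ w v
  trail-netOut {u} [] _ v = begin
    ∑[ e < m ] (0ℚ * incidence e v)  ≡⟨ sum-cong-≗ (λ e → *-zeroˡ (incidence e v)) ⟩
    ∑[ e < m ] 0ℚ                    ≡⟨ sum-replicate-zero m ⟩
    0ℚ                               ≡⟨ sym (+-inverseʳ (δ u v)) ⟩
    δ u v - δ u v                    ∎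
    where open ≡-Reasoning
  trail-netOut {w = w} (_∷_ {e = e₀} {P = P} refl W) (e₀∉P ∷ uniq) v = begin
    ∑[ e < m ] (⟦ e ∈ₗ? (e₀ ∷ P) ⟧ * incidence e v)
      ≡⟨ sum-cong-≗ (λ e → trans (cong (_* incidence e v) (⟦∈∷⟧ e₀∉P e)) (*-distribʳ-+ (incidence e v) (δ e₀ e) _)) ⟩
    ∑[ e < m ] (δ e₀ e * incidence e v + ⟦ e ∈ₗ? P ⟧ * incidence e v)
      ≡⟨ ∑-distrib-+ (λ e → δ e₀ e * incidence e v) _ ⟩
    ∑[ e < m ] (δ e₀ e * incidence e v) + ∑[ e < m ] (⟦ e ∈ₗ? P ⟧ * incidence e v)
      ≡⟨ cong₂ _+_ (∑-δ e₀ (λ e → incidence e v)) (trail-netOut W uniq v) ⟩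
    incidence e₀ v + (δ (head e₀) v - δ w v)
      ≡⟨ solve 3 (λ a b c → (a :- b) :+ (b :- c) := a :- c) refl (δ (tail e₀) v) (δ (head e₀) v) (δ w v) ⟩
    δ (tail e₀) v - δ w v ∎
    where open ≡-Reasoning

  path-netOut : ∀ {u w P} → IsPath H u w P → ∀ v →
                ∑[ e < m ] (⟦ e ∈ₗ? P ⟧ * incidence e v) ≡ δ u v - δ w v
  path-netOut (walk , vertices-unique) = trail-netOut walk (map⁻ (AllPairs.tail vertices-unique))

  ∑-potential-netOut : ∀ (π : Fin n → ℚ) h →
                       ∑[ v < n ] (π v * netOut h v) ≡ ∑[ e < m ] (h e * (π (tail e) - π (head e)))
  ∑-potential-netOut π h = begin
    ∑[ v < n ] (π v * netOut h v)
      ≡⟨ sum-cong-≗ (λ v → *-distribˡ-sum (π v) (λ e → h e * incidence e v)) ⟩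
    ∑[ v < n ] ∑[ e < m ] (π v * (h e * incidence e v))
      ≡⟨ ∑-comm (λ v e → π v * (h e * incidence e v)) ⟩
    ∑[ e < m ] ∑[ v < n ] (π v * (h e * incidence e v))
      ≡⟨ sum-cong-≗ edge ⟩
    ∑[ e < m ] (h e * (π (tail e) - π (head e))) ∎
    where
    open ≡-Reasoning
    edge : ∀ e → ∑[ v < n ] (π v * (h e * incidence e v)) ≡ h e * (π (tail e) - π (head e))
    edge e = begin
      ∑[ v < n ] (π v * (h e * incidence e v))
        ≡⟨ sum-cong-≗ (λ v → solve 4 (λ p c a b → p :* (c :* (a :- b)) := c :* (a :* p) :+ (:- c) :* (b :* p)) refl
                                      (π v) (h e) (δ (tail e) v) (δ (head e) v)) ⟩
      ∑[ v < n ] (h e * (δ (tail e) v * π v) + (- h e) * (δ (head e) v * π v))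
        ≡⟨ ∑-distrib-+ (λ v → h e * (δ (tail e) v * π v)) _ ⟩
      ∑[ v < n ] (h e * (δ (tail e) v * π v)) + ∑[ v < n ] ((- h e) * (δ (head e) v * π v))
        ≡⟨ sym (cong₂ _+_ (*-distribˡ-sum (h e) (λ v → δ (tail e) v * π v))
                          (*-distribˡ-sum (- h e) (λ v → δ (head e) v * π v))) ⟩
      h e * ∑[ v < n ] (δ (tail e) v * π v) + (- h e) * ∑[ v < n ] (δ (head e) v * π v)
        ≡⟨ cong₂ (λ a b → h e * a + (- h e) * b) (∑-δ (tail e) π) (∑-δ (head e) π) ⟩
      h e * π (tail e) + (- h e) * π (head e)
        ≡⟨ solve 3 (λ c a b → c :* a :+ (:- c) :* b := c :* (a :- b)) refl (h e) (π (tail e)) (π (head e)) ⟩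
      h e * (π (tail e) - π (head e)) ∎

  Carries : Fin n → Fin n → ℚ → (Fin m → ℚ) → Set
  Carries s t c h = ∀ v → netOut h v ≡ c * (δ s v - δ t v)

  cutFlow : Subset n → (Fin m → ℚ) → ℚ
  cutFlow R h = ∑[ e < m ] (h e * (⟦ tail e ∈ˢ? R ⟧ - ⟦ head e ∈ˢ? R ⟧))

  carries⇒cutFlow : ∀ {s t c h} → Carries s t c h → (R : Subset n) → s ∈ˢ R → t ∉ˢ R → cutFlow R h ≡ c
  carries⇒cutFlow {s} {t} {c} {h} carries R s∈R t∉R = begin
    cutFlow R h                                       ≡⟨ sym (∑-potential-netOut (λ v → ⟦ v ∈ˢ? R ⟧) h) ⟩
    ∑[ v < n ] (⟦ v ∈ˢ? R ⟧ * netOut h v)             ≡⟨ sum-cong-≗ (λ v → cong (⟦ v ∈ˢ? R ⟧ *_) (carries v)) ⟩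
    ∑[ v < n ] (⟦ v ∈ˢ? R ⟧ * (c * (δ s v - δ t v)))  ≡⟨ sum-cong-≗ inside-R ⟩
    ∑[ v < n ] (δ s v * c)                            ≡⟨ ∑-δ s (λ _ → c) ⟩
    c                                                 ∎
    where
    open ≡-Reasoning
    source : ∀ v → ⟦ v ∈ˢ? R ⟧ * δ s v ≡ δ s v
    source v with s ≟ᶠ v
    ... | yes refl = cong (_* 1ℚ) (⟦⟧-yes (s ∈ˢ? R) s∈R)
    ... | no _     = *-zeroʳ ⟦ v ∈ˢ? R ⟧
    sink : ∀ v → ⟦ v ∈ˢ? R ⟧ * δ t v ≡ 0ℚ
    sink v with t ≟ᶠ v
    ... | yes refl = trans (cong (_* 1ℚ) (⟦⟧-no (t ∈ˢ? R) t∉R)) (*-zeroˡ 1ℚ)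
    ... | no _     = *-zeroʳ ⟦ v ∈ˢ? R ⟧
    inside-R : ∀ v → ⟦ v ∈ˢ? R ⟧ * (c * (δ s v - δ t v)) ≡ δ s v * c
    inside-R v = begin
      ⟦ v ∈ˢ? R ⟧ * (c * (δ s v - δ t v))
        ≡⟨ solve 4 (λ r c a b → r :* (c :* (a :- b)) := c :* (r :* a :- r :* b)) refl ⟦ v ∈ˢ? R ⟧ c (δ s v) (δ t v) ⟩
      c * (⟦ v ∈ˢ? R ⟧ * δ s v - ⟦ v ∈ˢ? R ⟧ * δ t v)
        ≡⟨ cong₂ (λ a b → c * (a - b)) (source v) (sink v) ⟩
      c * (δ s v - 0ℚ)
        ≡⟨ solve 2 (λ c a → c :* (a :- con 0ℚ) := a :* c) refl c (δ s v) ⟩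
      δ s v * c ∎

module _ (H : Digraph) where
  open Digraph H

  Closed : Pred (Fin m) 0ℓ → Subset n → Set
  Closed U R = ∀ e → U e → tail e ∈ˢ R → head e ∈ˢ R

  module _ {U : Pred (Fin m) 0ℓ} (U? : Decidable U) (s t : Fin n) where

    UsablePath : Set
    UsablePath = ∃ λ P → IsPath H s t P × All U P

    ClosedCut : Set
    ClosedCut = ∃ λ R → s ∈ˢ R × t ∉ˢ R × Closed U R

    private
      ReachesSink : Subset n → Set
      ReachesSink V = ∀ {v} → v ∈ˢ V → ∃ λ P → IsPath H v t P × All U P × All (_∈ˢ V) (map head P)

      Entering : Subset n → Fin m → Set
      Entering V e = U e × tail e ∉ˢ V × head e ∈ˢ V

      entering? : ∀ V → Decidable (Entering V)
      entering? V e = U? e ×-dec ¬? (tail e ∈ˢ? V) ×-dec (head e ∈ˢ? V)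

      search : ∀ V → Acc _⊃_ V → t ∈ˢ V → ReachesSink V → UsablePath ⊎ ClosedCut
      search V (acc larger) t∈V reaches with any? (entering? V)
      ... | yes (e , usable , tail∉V , head∈V) =
        search V′ (larger (p⊆p∪q ⁅ tail e ⁆ , tail e , tail∈V′ , tail∉V)) (p⊆p∪q _ t∈V) reaches′
        where
        V′ : Subset n
        V′ = V ∪ ⁅ tail e ⁆

        tail∈V′ : tail e ∈ˢ V′
        tail∈V′ = x∈p∪q⁺ (inj₂ (x∈⁅x⁆ (tail e)))

        tail≢ : ∀ {w} → w ∈ˢ V → tail e ≢ w
        tail≢ w∈V refl = tail∉V w∈V

        reaches′ : ReachesSink V′
        reaches′ v∈V′ with x∈p∪q⁻ V ⁅ tail e ⁆ v∈V′
        ... | inj₁ v∈V = let P , isPath , usableP , inV = reaches v∈V in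
              P , isPath , usableP , All.map (p⊆p∪q _) inV
        ... | inj₂ v∈⁅tail⁆ with refl ← x∈⁅y⁆⇒x≡y _ v∈⁅tail⁆ =
              let P , (W , uniq) , usableP , inV = reaches head∈V in
              e ∷ P , (refl ∷ W , All.map tail≢ (head∈V ∷ inV) ∷ uniq) , usable ∷ usableP ,
              All.map (p⊆p∪q _) (head∈V ∷ inV)
      ... | no none with s ∈ˢ? V
      ...   | yes s∈V = let P , isPath , usableP , _ = reaches s∈V in inj₁ (P , isPath , usableP)
      ...   | no s∉V  = inj₂ (∁ V , x∉p⇒x∈∁p s∉V , x∈p⇒x∉∁p t∈V , closed)
        where
        closed : Closed U (∁ V)
        closed e usable tail∈∁V with head e ∈ˢ? V
        ... | yes head∈V = ⊥-elim (none (e , usable , x∈∁p⇒x∉p tail∈∁V , head∈V))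
        ... | no head∉V  = x∉p⇒x∈∁p head∉V

    usablePath-or-closedCut : UsablePath ⊎ ClosedCut
    usablePath-or-closedCut = search ⁅ t ⁆ (⊃-wellFounded _) (x∈⁅x⁆ t) trivial
      where
      trivial : ReachesSink ⁅ t ⁆
      trivial v∈⁅t⁆ with refl ← x∈⁅y⁆⇒x≡y t v∈⁅t⁆ = [] , ([] , [] ∷ []) , [] , []

-- Path flows

module _ (G : Digraph) where
  open Digraph G

  count-listsOfLength : ∀ l P → ∑ₗ (listsOfLength G l) (λ Q → ⟦ P ≟ₚ Q ⟧) ≡ ⟦ length P ℕ.≟ l ⟧
  count-listsOfLength zero    []      = +-identityʳ 1ℚ
  count-listsOfLength zero    (_ ∷ _) = +-identityʳ 0ℚ
  count-listsOfLength (suc l) P = begin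
    ∑ₗ (listsOfLength G (suc l)) (λ Q → ⟦ P ≟ₚ Q ⟧)
      ≡⟨ ∑ₗ-concatMap (λ e → map (e ∷_) (listsOfLength G l)) (allFin m) (λ Q → ⟦ P ≟ₚ Q ⟧) ⟩
    ∑ₗ (allFin m) (λ e → ∑ₗ (map (e ∷_) (listsOfLength G l)) (λ Q → ⟦ P ≟ₚ Q ⟧))
      ≡⟨ ∑ₗ-cong (allFin m) (λ {e} _ → ∑ₗ-map (e ∷_) (listsOfLength G l) (λ Q → ⟦ P ≟ₚ Q ⟧)) ⟩
    ∑ₗ (allFin m) (λ e → ∑ₗ (listsOfLength G l) (λ Q → ⟦ P ≟ₚ (e ∷ Q) ⟧))
      ≡⟨ extend P ⟩
    ⟦ length P ℕ.≟ suc l ⟧ ∎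
    where
    open ≡-Reasoning
    extend : ∀ P → ∑ₗ (allFin m) (λ e → ∑ₗ (listsOfLength G l) (λ Q → ⟦ P ≟ₚ (e ∷ Q) ⟧)) ≡
                   ⟦ length P ℕ.≟ suc l ⟧
    extend [] = trans (∑ₗ-cong (allFin m) (λ _ → ∑ₗ-zero (listsOfLength G l))) (∑ₗ-zero (allFin m))
    extend (e′ ∷ P) = begin
      ∑ₗ (allFin m) (λ e → ∑ₗ (listsOfLength G l) (λ Q → ⟦ (e′ ∷ P) ≟ₚ (e ∷ Q) ⟧))
        ≡⟨ ∑ₗ-cong (allFin m) (λ {e} _ → ∑ₗ-cong (listsOfLength G l) (λ {Q} _ → ⟦∷≟∷⟧ e′ e P Q)) ⟩
      ∑ₗ (allFin m) (λ e → ∑ₗ (listsOfLength G l) (λ Q → δ e′ e * ⟦ P ≟ₚ Q ⟧))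
        ≡⟨ ∑ₗ-cong (allFin m) (λ {e} _ → sym (*-distribˡ-∑ₗ (δ e′ e) (listsOfLength G l) (λ Q → ⟦ P ≟ₚ Q ⟧))) ⟩
      ∑ₗ (allFin m) (λ e → δ e′ e * ∑ₗ (listsOfLength G l) (λ Q → ⟦ P ≟ₚ Q ⟧))
        ≡⟨ ∑ₗ-tabulate (λ e → e) (λ e → δ e′ e * ∑ₗ (listsOfLength G l) (λ Q → ⟦ P ≟ₚ Q ⟧)) ⟩
      ∑[ e < m ] (δ e′ e * ∑ₗ (listsOfLength G l) (λ Q → ⟦ P ≟ₚ Q ⟧))
        ≡⟨ ∑-δ e′ (λ _ → ∑ₗ (listsOfLength G l) (λ Q → ⟦ P ≟ₚ Q ⟧)) ⟩
      ∑ₗ (listsOfLength G l) (λ Q → ⟦ P ≟ₚ Q ⟧)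
        ≡⟨ count-listsOfLength l P ⟩
      ⟦ length P ℕ.≟ l ⟧
        ≡⟨ ⟦⟧-⇔ (length P ℕ.≟ l) (suc (length P) ℕ.≟ suc l) (cong suc) ℕ.suc-injective ⟩
      ⟦ suc (length P) ℕ.≟ suc l ⟧ ∎

  count-paths : ∀ {s t P} → IsPath G s t P → ∑ₗ (paths G s t) (λ Q → ⟦ P ≟ₚ Q ⟧) ≡ 1ℚ
  count-paths {s} {t} {P} isPath = begin
    ∑ₗ (paths G s t) (λ Q → ⟦ P ≟ₚ Q ⟧)
      ≡⟨ ∑ₗ-filter (isPath? G s t) (candidates G) (λ Q → ⟦ P ≟ₚ Q ⟧) ⟩
    ∑ₗ (candidates G) (λ Q → ⟦ isPath? G s t Q ⟧ * ⟦ P ≟ₚ Q ⟧)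
      ≡⟨ ∑ₗ-cong (candidates G) (λ {Q} _ → *-comm ⟦ isPath? G s t Q ⟧ _) ⟩
    ∑ₗ (candidates G) (λ Q → ⟦ P ≟ₚ Q ⟧ * ⟦ isPath? G s t Q ⟧)
      ≡⟨ ∑ₗ-δ _≟ₚ_ (candidates G) P (λ Q → ⟦ isPath? G s t Q ⟧) ⟩
    ∑ₗ (candidates G) (λ Q → ⟦ P ≟ₚ Q ⟧) * ⟦ isPath? G s t P ⟧
      ≡⟨ cong₂ _*_ count-candidates (⟦⟧-yes (isPath? G s t P) isPath) ⟩
    1ℚ * 1ℚ
      ≡⟨ *-identityˡ 1ℚ ⟩
    1ℚ ∎
    where
    open ≡-Reasoning
    length≤n : length P ℕ.≤ n
    length≤n = ℕ.<⇒≤ (subst (ℕ._< n) (length-map head P) (unique-length≤ (proj₂ isPath)))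
    count-candidates : ∑ₗ (candidates G) (λ Q → ⟦ P ≟ₚ Q ⟧) ≡ 1ℚ
    count-candidates = begin
      ∑ₗ (candidates G) (λ Q → ⟦ P ≟ₚ Q ⟧)
        ≡⟨ ∑ₗ-concatMap (listsOfLength G) (upTo (suc n)) (λ Q → ⟦ P ≟ₚ Q ⟧) ⟩
      ∑ₗ (upTo (suc n)) (λ l → ∑ₗ (listsOfLength G l) (λ Q → ⟦ P ≟ₚ Q ⟧))
        ≡⟨ ∑ₗ-cong (upTo (suc n)) (λ {l} _ → count-listsOfLength l P) ⟩
      ∑ₗ (upTo (suc n)) (λ l → ⟦ length P ℕ.≟ l ⟧)
        ≡⟨ count-unique ℕ._≟_ (upTo⁺ (suc n)) (∈-upTo⁺ (s≤s length≤n)) ⟩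
      1ℚ ∎

  ∑ₗ-paths-δ : ∀ {s t P} → IsPath G s t P → ∀ (f : List (Fin m) → ℚ) →
               ∑ₗ (paths G s t) (λ Q → ⟦ P ≟ₚ Q ⟧ * f Q) ≡ f P
  ∑ₗ-paths-δ {s} {t} {P} isPath f =
    trans (∑ₗ-δ _≟ₚ_ (paths G s t) P f) (trans (cong (_* f P) (count-paths isPath)) (*-identityˡ (f P)))

  addPath : List (Fin m) → ℚ → PathVec G → PathVec G
  addPath P a y Q = a * ⟦ P ≟ₚ Q ⟧ + y Q

  module _ (s t : Fin n) where

    ∈paths⇒IsPath : ∀ {P} → P ∈ paths G s t → IsPath G s t P
    ∈paths⇒IsPath P∈paths = proj₂ (∈-filter⁻ (isPath? G s t) {xs = candidates G} P∈paths)

    load-∑ₗ : ∀ y e → load G s t y e ≡ ∑ₗ (paths G s t) (λ P → ⟦ e ∈ₗ? P ⟧ * y P)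
    load-∑ₗ y e = ∑ₗ-filter (e ∈ₗ?_) (paths G s t) y

    load-carries : ∀ y → Carries G s t (val G s t y) (load G s t y)
    load-carries y v = begin
      ∑[ e < m ] (load G s t y e * incidence G e v)
        ≡⟨ sum-cong-≗ (λ e → trans (cong (_* incidence G e v) (load-∑ₗ y e))
                                   (*-distribʳ-∑ₗ (incidence G e v) (paths G s t) (λ P → ⟦ e ∈ₗ? P ⟧ * y P))) ⟩
      ∑[ e < m ] ∑ₗ (paths G s t) (λ P → ⟦ e ∈ₗ? P ⟧ * y P * incidence G e v)
        ≡⟨ sym (∑ₗ-comm-∑ (paths G s t) (λ P e → ⟦ e ∈ₗ? P ⟧ * y P * incidence G e v)) ⟩
      ∑ₗ (paths G s t) (λ P → ∑[ e < m ] (⟦ e ∈ₗ? P ⟧ * y P * incidence G e v))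
        ≡⟨ ∑ₗ-cong (paths G s t) along-path ⟩
      ∑ₗ (paths G s t) (λ P → y P * (δ s v - δ t v))
        ≡⟨ sym (*-distribʳ-∑ₗ (δ s v - δ t v) (paths G s t) y) ⟩
      val G s t y * (δ s v - δ t v) ∎
      where
      open ≡-Reasoning
      along-path : ∀ {P} → P ∈ paths G s t → ∑[ e < m ] (⟦ e ∈ₗ? P ⟧ * y P * incidence G e v) ≡ y P * (δ s v - δ t v)
      along-path {P} P∈paths = begin
        ∑[ e < m ] (⟦ e ∈ₗ? P ⟧ * y P * incidence G e v)
          ≡⟨ sum-cong-≗ (λ e → solve 3 (λ a b c → a :* b :* c := b :* (a :* c)) refl ⟦ e ∈ₗ? P ⟧ (y P) (incidence G e v)) ⟩
        ∑[ e < m ] (y P * (⟦ e ∈ₗ? P ⟧ * incidence G e v))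
          ≡⟨ sym (*-distribˡ-sum (y P) (λ e → ⟦ e ∈ₗ? P ⟧ * incidence G e v)) ⟩
        y P * ∑[ e < m ] (⟦ e ∈ₗ? P ⟧ * incidence G e v)
          ≡⟨ cong (y P *_) (path-netOut G (∈paths⇒IsPath P∈paths) v) ⟩
        y P * (δ s v - δ t v) ∎

  module _ {s t P} (isPath : IsPath G s t P) (a : ℚ) (y : PathVec G) where

    val-addPath : val G s t (addPath P a y) ≡ a + val G s t y
    val-addPath = begin
      ∑ₗ (paths G s t) (λ Q → a * ⟦ P ≟ₚ Q ⟧ + y Q)
        ≡⟨ ∑ₗ-distrib-+ (paths G s t) (λ Q → a * ⟦ P ≟ₚ Q ⟧) y ⟩
      ∑ₗ (paths G s t) (λ Q → a * ⟦ P ≟ₚ Q ⟧) + val G s t y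
        ≡⟨ cong (_+ val G s t y) (sym (*-distribˡ-∑ₗ a (paths G s t) (λ Q → ⟦ P ≟ₚ Q ⟧))) ⟩
      a * ∑ₗ (paths G s t) (λ Q → ⟦ P ≟ₚ Q ⟧) + val G s t y
        ≡⟨ cong (λ c → a * c + val G s t y) (count-paths isPath) ⟩
      a * 1ℚ + val G s t y
        ≡⟨ cong (_+ val G s t y) (*-identityʳ a) ⟩
      a + val G s t y ∎
      where open ≡-Reasoning

    load-addPath : ∀ e → load G s t (addPath P a y) e ≡ a * ⟦ e ∈ₗ? P ⟧ + load G s t y e
    load-addPath e = begin
      load G s t (addPath P a y) e
        ≡⟨ load-∑ₗ s t (addPath P a y) e ⟩
      ∑ₗ (paths G s t) (λ Q → ⟦ e ∈ₗ? Q ⟧ * (a * ⟦ P ≟ₚ Q ⟧ + y Q))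
        ≡⟨ ∑ₗ-cong (paths G s t) (λ {Q} _ → solve 4 (λ i a d y → i :* (a :* d :+ y) := a :* (d :* i) :+ i :* y) refl
                                                   ⟦ e ∈ₗ? Q ⟧ a ⟦ P ≟ₚ Q ⟧ (y Q)) ⟩
      ∑ₗ (paths G s t) (λ Q → a * (⟦ P ≟ₚ Q ⟧ * ⟦ e ∈ₗ? Q ⟧) + ⟦ e ∈ₗ? Q ⟧ * y Q)
        ≡⟨ ∑ₗ-distrib-+ (paths G s t) (λ Q → a * (⟦ P ≟ₚ Q ⟧ * ⟦ e ∈ₗ? Q ⟧)) _ ⟩
      ∑ₗ (paths G s t) (λ Q → a * (⟦ P ≟ₚ Q ⟧ * ⟦ e ∈ₗ? Q ⟧)) + ∑ₗ (paths G s t) (λ Q → ⟦ e ∈ₗ? Q ⟧ * y Q)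
        ≡⟨ cong₂ _+_ (sym (*-distribˡ-∑ₗ a (paths G s t) _)) (sym (load-∑ₗ s t y e)) ⟩
      a * ∑ₗ (paths G s t) (λ Q → ⟦ P ≟ₚ Q ⟧ * ⟦ e ∈ₗ? Q ⟧) + load G s t y e
        ≡⟨ cong (λ c → a * c + load G s t y e) (∑ₗ-paths-δ isPath (λ Q → ⟦ e ∈ₗ? Q ⟧)) ⟩
      a * ⟦ e ∈ₗ? P ⟧ + load G s t y e ∎
      where open ≡-Reasoning

-- Flow decomposition

module _ (G : Digraph) where
  open Digraph G

  cutFlow-nonPos : ∀ {h} R → (∀ e → 0ℚ ≤ h e) → Closed G (λ e → 0ℚ < h e) R → cutFlow G R h ≤ 0ℚ
  cutFlow-nonPos {h} R nonNeg closed = subst (cutFlow G R h ≤_) (sum-replicate-zero m) (∑-mono-≤ crossing)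
    where
    crossing : ∀ e → h e * (⟦ tail e ∈ˢ? R ⟧ - ⟦ head e ∈ˢ? R ⟧) ≤ 0ℚ
    crossing e with tail e ∈ˢ? R | head e ∈ˢ? R
    ... | yes _ | yes _ = ≤-reflexive (solve 1 (λ x → x :* (con 1ℚ :- con 1ℚ) := con 0ℚ) refl (h e))
    ... | no _  | no _  = ≤-reflexive (solve 1 (λ x → x :* (con 0ℚ :- con 0ℚ) := con 0ℚ) refl (h e))
    ... | no _  | yes _ = subst (_≤ 0ℚ) (solve 1 (λ x → :- x := x :* (con 0ℚ :- con 1ℚ)) refl (h e)) (neg-antimono-≤ (nonNeg e))
    ... | yes tail∈R | no head∉R with 0ℚ <? h e
    ...   | yes positive = ⊥-elim (head∉R (closed e positive tail∈R))
    ...   | no ¬positive =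
      ≤-reflexive (trans (cong (_* (1ℚ - 0ℚ)) (≤-antisym (≮⇒≥ ¬positive) (nonNeg e))) (*-zeroˡ (1ℚ - 0ℚ)))

  module _ {s t : Fin n} where

    carries-minus-path : ∀ {c h P} → Carries G s t c h → IsPath G s t P → ∀ a →
                         Carries G s t (c - a) (λ e → h e - a * ⟦ e ∈ₗ? P ⟧)
    carries-minus-path {c} {h} {P} carries isPath a v = begin
      ∑[ e < m ] ((h e - a * ⟦ e ∈ₗ? P ⟧) * incidence G e v)
        ≡⟨ sum-cong-≗ (λ e → solve 4 (λ x a i d → (x :- a :* i) :* d := x :* d :+ (:- a) :* (i :* d)) refl
                                       (h e) a ⟦ e ∈ₗ? P ⟧ (incidence G e v)) ⟩
      ∑[ e < m ] (h e * incidence G e v + (- a) * (⟦ e ∈ₗ? P ⟧ * incidence G e v))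
        ≡⟨ ∑-distrib-+ (λ e → h e * incidence G e v) _ ⟩
      netOut G h v + ∑[ e < m ] ((- a) * (⟦ e ∈ₗ? P ⟧ * incidence G e v))
        ≡⟨ cong₂ _+_ (carries v) (sym (*-distribˡ-sum (- a) (λ e → ⟦ e ∈ₗ? P ⟧ * incidence G e v))) ⟩
      c * (δ s v - δ t v) + (- a) * ∑[ e < m ] (⟦ e ∈ₗ? P ⟧ * incidence G e v)
        ≡⟨ cong (λ x → c * (δ s v - δ t v) + (- a) * x) (path-netOut G isPath v) ⟩
      c * (δ s v - δ t v) + (- a) * (δ s v - δ t v)
        ≡⟨ solve 3 (λ c a d → c :* d :+ (:- a) :* d := (c :- a) :* d) refl c a (δ s v - δ t v) ⟩
      (c - a) * (δ s v - δ t v) ∎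
      where open ≡-Reasoning

    Decomposition : ℚ → (Fin m → ℚ) → Set
    Decomposition c h = ∃ λ z → (∀ P → 0ℚ ≤ z P) × c ≤ val G s t z × (∀ e → load G s t z e ≤ h e)

    decomposition-≤0 : ∀ {c h} → c ≤ 0ℚ → (∀ e → 0ℚ ≤ h e) → Decomposition c h
    decomposition-≤0 {c} {h} c≤0 nonNeg =
      (λ _ → 0ℚ) , (λ _ → ≤-refl) , subst (c ≤_) (sym (∑ₗ-zero (paths G s t))) c≤0 ,
      (λ e → subst (_≤ h e) (sym (∑ₗ-zero (filter (e ∈ₗ?_) (paths G s t)))) (nonNeg e))

    positive? : (h : Fin m → ℚ) → Decidable (λ e → 0ℚ < h e)
    positive? h e = 0ℚ <? h e

    support : (Fin m → ℚ) → Subset m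
    support h = subsetOf (positive? h)

    -- Peeling off a path at its bottleneck value empties the bottleneck edge, so the support shrinks.
    module Peel {c h e₀ P} (nonNeg : ∀ e → 0ℚ ≤ h e) (carries : Carries G s t c h)
                (isPath : IsPath G s t (e₀ ∷ P)) (positive : All (λ e → 0ℚ < h e) (e₀ ∷ P)) where

      bottleneck : Fin m
      bottleneck = argmin h e₀ P

      a : ℚ
      a = h bottleneck

      h′ : Fin m → ℚ
      h′ e = h e - a * ⟦ e ∈ₗ? (e₀ ∷ P) ⟧

      0<a : 0ℚ < a
      0<a = argmin-all h (All.head positive) (All.tail positive)

      a≤h : All (λ e → a ≤ h e) (e₀ ∷ P)
      a≤h = f[argmin]≤f[⊤] {f = h} e₀ P ∷ f[argmin]≤f[xs] {f = h} e₀ P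

      bottleneck∈ : bottleneck ∈ e₀ ∷ P
      bottleneck∈ = argmin-all h (here refl) (All.tabulate there)

      0≤h′ : ∀ e → 0ℚ ≤ h′ e
      0≤h′ e = 0≤q-p (*⟦⟧≤ (e ∈ₗ? (e₀ ∷ P)) (All.lookup a≤h) (nonNeg e))

      h′≤h : ∀ e → h′ e ≤ h e
      h′≤h e = subst₂ _≤_ (+-identityʳ (h′ e)) (solve 2 (λ x y → x :- y :+ y := x) refl (h e) (a * ⟦ e ∈ₗ? (e₀ ∷ P) ⟧))
                 (+-monoʳ-≤ (h′ e) (*-nonNeg (<⇒≤ 0<a) (0≤⟦⟧ (e ∈ₗ? (e₀ ∷ P)))))

      h′-bottleneck : h′ bottleneck ≡ 0ℚ
      h′-bottleneck = trans (cong (λ i → a - a * i) (⟦⟧-yes (bottleneck ∈ₗ? (e₀ ∷ P)) bottleneck∈))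
                            (solve 1 (λ x → x :- x :* con 1ℚ := con 0ℚ) refl a)

      support-shrinks : support h′ ⊂ support h
      support-shrinks = shrinks , bottleneck , ∈-subsetOf⁺ (positive? h) 0<a , bottleneck∉
        where
        shrinks : ∀ {e} → e ∈ˢ support h′ → e ∈ˢ support h
        shrinks {e} e∈ = ∈-subsetOf⁺ (positive? h) (<-≤-trans (∈-subsetOf⁻ (positive? h′) e∈) (h′≤h e))
        bottleneck∉ : bottleneck ∉ˢ support h′
        bottleneck∉ b∈ = <-irrefl (sym h′-bottleneck) (∈-subsetOf⁻ (positive? h′) b∈)

      extend : Decomposition (c - a) h′ → Decomposition c h
      extend (z , 0≤z , c-a≤val , load≤h′) = addPath G (e₀ ∷ P) a z , 0≤z′ , c≤val′ , load≤h
        where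
        0≤z′ : ∀ Q → 0ℚ ≤ addPath G (e₀ ∷ P) a z Q
        0≤z′ Q = +-mono-≤ (*-nonNeg (<⇒≤ 0<a) (0≤⟦⟧ ((e₀ ∷ P) ≟ₚ Q))) (0≤z Q)
        c≤val′ : c ≤ val G s t (addPath G (e₀ ∷ P) a z)
        c≤val′ = subst₂ _≤_ (solve 2 (λ c a → a :+ (c :- a) := c) refl c a) (sym (val-addPath G isPath a z))
                            (+-monoʳ-≤ a c-a≤val)
        load≤h : ∀ e → load G s t (addPath G (e₀ ∷ P) a z) e ≤ h e
        load≤h e = subst₂ _≤_ (sym (load-addPath G isPath a z e))
                              (solve 2 (λ x y → y :+ (x :- y) := x) refl (h e) (a * ⟦ e ∈ₗ? (e₀ ∷ P) ⟧))
                              (+-monoʳ-≤ (a * ⟦ e ∈ₗ? (e₀ ∷ P) ⟧) (load≤h′ e))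

    decompose : s ≢ t → ∀ {c h} → (∀ e → 0ℚ ≤ h e) → Carries G s t c h → Decomposition c h
    decompose s≢t {h = h} = go (⊂-wellFounded (support h))
      where
      go : ∀ {c h} → Acc _⊂_ (support h) → (∀ e → 0ℚ ≤ h e) → Carries G s t c h → Decomposition c h
      go {c} {h} (acc smaller) nonNeg carries with c ≤? 0ℚ
      ... | yes c≤0 = decomposition-≤0 c≤0 nonNeg
      ... | no c≰0 with usablePath-or-closedCut G (positive? h) s t
      ...   | inj₂ (R , s∈R , t∉R , closed) =
                ⊥-elim (c≰0 (subst (_≤ 0ℚ) (carries⇒cutFlow G {c = c} {h = h} carries R s∈R t∉R)
                                           (cutFlow-nonPos {h = h} R nonNeg closed)))
      ...   | inj₁ ([] , ([] , _) , _) = ⊥-elim (s≢t refl)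
      ...   | inj₁ (e₀ ∷ P , isPath , positive) =
                extend (go (smaller support-shrinks) 0≤h′ (carries-minus-path {c = c} {h = h} carries isPath a))
        where open Peel {c = c} nonNeg carries isPath positive

-- Augmenting paths and saturated cuts

module _ (G : Digraph) where
  open Digraph G

  -- Edge e ↑ˡ m is e itself and edge m ↑ʳ e is e reversed.
  bidirected : Digraph
  bidirected = record
    { n = n ; m = m ℕ.+ m ; tail = [ tail , head ]′ ∘ splitAt m ; head = [ head , tail ]′ ∘ splitAt m }

  incidence-forward : ∀ e v → incidence bidirected (e ↑ˡ m) v ≡ incidence G e v
  incidence-forward e v rewrite splitAt-↑ˡ m e m = refl

  incidence-backward : ∀ e v → incidence bidirected (m ↑ʳ e) v ≡ - incidence G e v
  incidence-backward e v rewrite splitAt-↑ʳ m m e =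
    solve 2 (λ a b → b :- a := :- (a :- b)) refl (δ (tail e) v) (δ (head e) v)

  Residual : (Fin m → ℚ) → Pred (Fin (m ℕ.+ m)) 0ℓ
  Residual f r = [ (λ e → f e < 1ℚ) , (λ e → 0ℚ < f e) ]′ (splitAt m r)

  residual? : ∀ f → Decidable (Residual f)
  residual? f r with splitAt m r
  ... | inj₁ e = f e <? 1ℚ
  ... | inj₂ e = 0ℚ <? f e

  slack : (Fin m → ℚ) → Fin (m ℕ.+ m) → ℚ
  slack f r = [ (λ e → 1ℚ - f e) , f ]′ (splitAt m r)

  slack-forward : ∀ f e → slack f (e ↑ˡ m) ≡ 1ℚ - f e
  slack-forward f e rewrite splitAt-↑ˡ m e m = refl

  slack-backward : ∀ f e → slack f (m ↑ʳ e) ≡ f e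
  slack-backward f e rewrite splitAt-↑ʳ m m e = refl

  0<slack : ∀ f r → Residual f r → 0ℚ < slack f r
  0<slack f r with splitAt m r
  ... | inj₁ e = λ f<1 → subst (_< 1ℚ - f e) (+-inverseʳ (f e)) (+-monoˡ-< (- f e) f<1)
  ... | inj₂ e = λ 0<f → 0<f

  module _ {f R} (closed : Closed bidirected (Residual f) R) where

    private
      Step : Fin m ⊎ Fin m → Set
      Step u = [ (λ e → f e < 1ℚ) , (λ e → 0ℚ < f e) ]′ u → [ tail , head ]′ u ∈ˢ R → [ head , tail ]′ u ∈ˢ R

    closed-forward : ∀ e → f e < 1ℚ → tail e ∈ˢ R → head e ∈ˢ R
    closed-forward e = subst Step (splitAt-↑ˡ m e m) (closed (e ↑ˡ m))

    closed-backward : ∀ e → 0ℚ < f e → head e ∈ˢ R → tail e ∈ˢ R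
    closed-backward e = subst Step (splitAt-↑ʳ m m e) (closed (m ↑ʳ e))

  module _ {s t : Fin n} {x : PathVec G} (unit : IsUnitFlow G s t x) where

    private
      f : Fin m → ℚ
      f = load G s t x

    0≤load : ∀ e → 0ℚ ≤ f e
    0≤load e = subst (0ℚ ≤_) (sym (load-∑ₗ G s t x e))
      (∑ₗ-nonNeg (paths G s t) (λ {P} P∈ → *-nonNeg (0≤⟦⟧ (e ∈ₗ? P)) (proj₁ unit P (∈paths⇒IsPath G s t P∈))))

    module Augment {r₀ W} (augmenting : IsPath bidirected s t (r₀ ∷ W)) (residual : All (Residual f) (r₀ ∷ W)) where

      ε : ℚ
      ε = slack f (argmin (slack f) r₀ W)

      0<ε : 0ℚ < ε
      0<ε = argmin-all (slack f) (0<slack f r₀ (All.head residual)) (All.map (0<slack f _) (All.tail residual))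

      ε≤slack : All (λ r → ε ≤ slack f r) (r₀ ∷ W)
      ε≤slack = f[argmin]≤f[⊤] {f = slack f} r₀ W ∷ f[argmin]≤f[xs] {f = slack f} r₀ W

      forward backward : Fin m → ℚ
      forward  e = ⟦ (e ↑ˡ m) ∈ₗ? (r₀ ∷ W) ⟧
      backward e = ⟦ (m ↑ʳ e) ∈ₗ? (r₀ ∷ W) ⟧

      f′ : Fin m → ℚ
      f′ e = f e + ε * (forward e - backward e)

      0≤ε*forward : ∀ e → 0ℚ ≤ ε * forward e
      0≤ε*forward e = *-nonNeg (<⇒≤ 0<ε) (0≤⟦⟧ ((e ↑ˡ m) ∈ₗ? (r₀ ∷ W)))

      0≤ε*backward : ∀ e → 0ℚ ≤ ε * backward e
      0≤ε*backward e = *-nonNeg (<⇒≤ 0<ε) (0≤⟦⟧ ((m ↑ʳ e) ∈ₗ? (r₀ ∷ W)))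

      ε*forward≤ : ∀ e → ε * forward e ≤ 1ℚ - f e
      ε*forward≤ e = *⟦⟧≤ ((e ↑ˡ m) ∈ₗ? (r₀ ∷ W))
        (λ r∈ → subst (ε ≤_) (slack-forward f e) (All.lookup ε≤slack r∈)) (0≤q-p (proj₂ unit e))

      ε*backward≤ : ∀ e → ε * backward e ≤ f e
      ε*backward≤ e = *⟦⟧≤ ((m ↑ʳ e) ∈ₗ? (r₀ ∷ W))
        (λ r∈ → subst (ε ≤_) (slack-backward f e) (All.lookup ε≤slack r∈)) (0≤load e)

      0≤f′ : ∀ e → 0ℚ ≤ f′ e
      0≤f′ e = subst₂ _≤_ (+-identityʳ 0ℚ)
        (solve 4 (λ x a F B → x :- a :* B :+ a :* F := x :+ a :* (F :- B)) refl (f e) ε (forward e) (backward e))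
        (+-mono-≤ (0≤q-p (ε*backward≤ e)) (0≤ε*forward e))

      f′≤1 : ∀ e → f′ e ≤ 1ℚ
      f′≤1 e = begin
        f′ e                   ≤⟨ subst (_≤ f′ e + ε * backward e) (+-identityʳ (f′ e)) (+-monoʳ-≤ (f′ e) (0≤ε*backward e)) ⟩
        f′ e + ε * backward e  ≡⟨ solve 4 (λ x a F B → x :+ a :* (F :- B) :+ a :* B := x :+ a :* F) refl
                                          (f e) ε (forward e) (backward e) ⟩
        f e + ε * forward e    ≤⟨ +-monoʳ-≤ (f e) (ε*forward≤ e) ⟩
        f e + (1ℚ - f e)       ≡⟨ solve 1 (λ x → x :+ (con 1ℚ :- x) := con 1ℚ) refl (f e) ⟩
        1ℚ                     ∎
        where open ≤-Reasoning

      augmenting-carries : Carries G s t 1ℚ (λ e → forward e - backward e)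
      augmenting-carries v = begin
        ∑[ e < m ] ((forward e - backward e) * incidence G e v)
          ≡⟨ sum-cong-≗ split ⟩
        ∑[ e < m ] (forward e * incidence bidirected (e ↑ˡ m) v + backward e * incidence bidirected (m ↑ʳ e) v)
          ≡⟨ ∑-distrib-+ (λ e → forward e * incidence bidirected (e ↑ˡ m) v) _ ⟩
        ∑[ e < m ] (forward e * incidence bidirected (e ↑ˡ m) v) + ∑[ e < m ] (backward e * incidence bidirected (m ↑ʳ e) v)
          ≡⟨ sym (∑-↑ m (λ r → ⟦ r ∈ₗ? (r₀ ∷ W) ⟧ * incidence bidirected r v)) ⟩
        ∑[ r < m ℕ.+ m ] (⟦ r ∈ₗ? (r₀ ∷ W) ⟧ * incidence bidirected r v)
          ≡⟨ path-netOut bidirected augmenting v ⟩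
        δ s v - δ t v
          ≡⟨ sym (*-identityˡ _) ⟩
        1ℚ * (δ s v - δ t v) ∎
        where
        open ≡-Reasoning
        split : ∀ e → (forward e - backward e) * incidence G e v ≡
                      forward e * incidence bidirected (e ↑ˡ m) v + backward e * incidence bidirected (m ↑ʳ e) v
        split e rewrite incidence-forward e v | incidence-backward e v =
          solve 3 (λ F B d → (F :- B) :* d := F :* d :+ B :* (:- d)) refl (forward e) (backward e) (incidence G e v)

      carries′ : Carries G s t (val G s t x + ε) f′
      carries′ v = begin
        ∑[ e < m ] ((f e + ε * (forward e - backward e)) * incidence G e v)
          ≡⟨ sum-cong-≗ (λ e → solve 4 (λ x a g d → (x :+ a :* g) :* d := x :* d :+ a :* (g :* d)) refl
                                         (f e) ε (forward e - backward e) (incidence G e v)) ⟩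
        ∑[ e < m ] (f e * incidence G e v + ε * ((forward e - backward e) * incidence G e v))
          ≡⟨ ∑-distrib-+ (λ e → f e * incidence G e v) _ ⟩
        netOut G f v + ∑[ e < m ] (ε * ((forward e - backward e) * incidence G e v))
          ≡⟨ cong₂ _+_ (load-carries G s t x v) (sym (*-distribˡ-sum ε (λ e → (forward e - backward e) * incidence G e v))) ⟩
        val G s t x * (δ s v - δ t v) + ε * netOut G (λ e → forward e - backward e) v
          ≡⟨ cong (λ y → val G s t x * (δ s v - δ t v) + ε * y) (augmenting-carries v) ⟩
        val G s t x * (δ s v - δ t v) + ε * (1ℚ * (δ s v - δ t v))
          ≡⟨ solve 3 (λ c a d → c :* d :+ a :* (con 1ℚ :* d) := (c :+ a) :* d) refl (val G s t x) ε (δ s v - δ t v) ⟩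
        (val G s t x + ε) * (δ s v - δ t v) ∎
        where open ≡-Reasoning

    augment : s ≢ t → UsablePath bidirected (residual? f) s t → ∃ λ z → IsUnitFlow G s t z × val G s t x < val G s t z
    augment s≢t ([] , ([] , _) , _) = ⊥-elim (s≢t refl)
    augment s≢t (r₀ ∷ W , augmenting , residual) =
      let z , 0≤z , val≤ , load≤f′ = decompose G s≢t 0≤f′ carries′ in
      z , ((λ P _ → 0≤z P) , (λ e → ≤-trans (load≤f′ e) (f′≤1 e))) ,
      <-≤-trans (subst (_< val G s t x + ε) (+-identityʳ _) (+-monoʳ-< (val G s t x) 0<ε)) val≤
      where open Augment augmenting residual

module _ (G : Digraph) where
  open Digraph G

  Leaves : Subset n → Fin m → Set
  Leaves R e = tail e ∈ˢ R × head e ∉ˢ R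

  leaves? : ∀ R → Decidable (Leaves R)
  leaves? R e = tail e ∈ˢ? R ×-dec ¬? (head e ∈ˢ? R)

  cutEdges : Subset n → Subset m
  cutEdges R = subsetOf (leaves? R)

  module _ {s t : Fin n} {x : PathVec G} (unit : IsUnitFlow G s t x) where

    private
      f : Fin m → ℚ
      f = load G s t x

    -- No flow enters R and every edge leaving R is saturated.
    saturated : ∀ R → Closed (bidirected G) (Residual G f) R →
                ∀ e → f e * (⟦ tail e ∈ˢ? R ⟧ - ⟦ head e ∈ˢ? R ⟧) ≡ ⟦ e ∈ˢ? cutEdges R ⟧
    saturated R closed e = trans (crossing (tail e ∈ˢ? R) (head e ∈ˢ? R))
                                 (⟦⟧-⇔ (leaves? R e) (e ∈ˢ? cutEdges R) (∈-subsetOf⁺ (leaves? R)) (∈-subsetOf⁻ (leaves? R)))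
      where
      crossing : (tail? : Dec (tail e ∈ˢ R)) (head? : Dec (head e ∈ˢ R)) →
                 f e * (⟦ tail? ⟧ - ⟦ head? ⟧) ≡ ⟦ tail? ×-dec ¬? head? ⟧
      crossing (yes _) (yes _) = solve 1 (λ x → x :* (con 1ℚ :- con 1ℚ) := con 0ℚ) refl (f e)
      crossing (no _)  (no _)  = solve 1 (λ x → x :* (con 0ℚ :- con 0ℚ) := con 0ℚ) refl (f e)
      crossing (no tail∉R) (yes head∈R) with 0ℚ <? f e
      ... | yes 0<f = ⊥-elim (tail∉R (closed-backward G closed e 0<f head∈R))
      ... | no 0≮f  = trans (cong (_* (0ℚ - 1ℚ)) (≤-antisym (≮⇒≥ 0≮f) (0≤load G unit e))) (*-zeroˡ (0ℚ - 1ℚ))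
      crossing (yes tail∈R) (no head∉R) with f e <? 1ℚ
      ... | yes f<1 = ⊥-elim (head∉R (closed-forward G closed e f<1 tail∈R))
      ... | no f≮1  = trans (cong (_* (1ℚ - 0ℚ)) (≤-antisym (proj₂ unit e) (≮⇒≥ f≮1))) (*-identityˡ (1ℚ - 0ℚ))

  maxFlow⇒saturatedCut : ∀ {s t x} → IsMaxFlow G s t x → s ≢ t →
                         ∃ λ R → s ∈ˢ R × t ∉ˢ R × val G s t x ≡ fromℕ ∣ cutEdges R ∣
  maxFlow⇒saturatedCut {s} {t} {x} (unit , maximal) s≢t
    with usablePath-or-closedCut (bidirected G) (residual? G (load G s t x)) s t
  ... | inj₁ augmenting = let z , unit-z , x<z = augment G unit s≢t augmenting in
                          ⊥-elim (<-irrefl refl (<-≤-trans x<z (maximal z unit-z)))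
  ... | inj₂ (R , s∈R , t∉R , closed) = R , s∈R , t∉R , (begin
    val G s t x                      ≡⟨ sym (carries⇒cutFlow G {h = load G s t x} (load-carries G s t x) R s∈R t∉R) ⟩
    cutFlow G R (load G s t x)       ≡⟨ sum-cong-≗ (saturated unit R closed) ⟩
    ∑[ e < m ] ⟦ e ∈ˢ? cutEdges R ⟧  ≡⟨ ∑-⟦∈⟧ (cutEdges R) ⟩
    fromℕ ∣ cutEdges R ∣             ∎)
    where open ≡-Reasoning

  ¬maxFlow-s→s : ∀ {s x} → ¬ IsMaxFlow G s s x
  ¬maxFlow-s→s {s} {x} (unit , maximal) = <-irrefl refl (<-≤-trans x<x′ (maximal x′ unit′))
    where
    x′ : PathVec G
    x′ = addPath G [] 1ℚ x
    empty : IsPath G s s []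
    empty = [] , [] ∷ []
    load-x′ : ∀ e → load G s s x′ e ≡ load G s s x e
    load-x′ e = trans (load-addPath G empty 1ℚ x e) (trans (cong (_+ load G s s x e) (*-zeroʳ 1ℚ)) (+-identityˡ _))
    unit′ : IsUnitFlow G s s x′
    unit′ = (λ P isPath → +-mono-≤ (*-nonNeg 0≤1 (0≤⟦⟧ ([] ≟ₚ P))) (proj₁ unit P isPath)) ,
            (λ e → subst (_≤ 1ℚ) (sym (load-x′ e)) (proj₂ unit e))
    x<x′ : val G s s x < val G s s x′
    x<x′ = subst (val G s s x <_) (sym (val-addPath G empty 1ℚ x))
                 (subst (_< 1ℚ + val G s s x) (+-identityˡ _) (+-monoˡ-< (val G s s x) (positive⁻¹ 1ℚ)))

-- Robust flow value

module _ (G : Digraph) where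
  open Digraph G

  ∈-allSubsets : ∀ {k} (S : Subset k) → S ∈ allSubsets G k
  ∈-allSubsets Vec.[]          = here refl
  ∈-allSubsets {suc k} (true  Vec.∷ S) = ∈-concatMap⁺ (λ b → map (b Vec.∷_) (allSubsets G k)) {xs = true ∷ false ∷ []}
                                           (here (∈-map⁺ (true Vec.∷_) (∈-allSubsets S)))
  ∈-allSubsets {suc k} (false Vec.∷ S) = ∈-concatMap⁺ (λ b → map (b Vec.∷_) (allSubsets G k)) {xs = true ∷ false ∷ []}
                                           (there (here (∈-map⁺ (false Vec.∷_) (∈-allSubsets S))))

  ∈-kSubsets⁺ : ∀ {k} {S : Subset m} → ∣ S ∣ ≡ k → S ∈ kSubsets G k
  ∈-kSubsets⁺ {k} {S} ∣S∣≡k = ∈-filter⁺ (λ S → ∣ S ∣ ℕ.≟ k) {xs = allSubsets G m} (∈-allSubsets S) ∣S∣≡k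

  ∈-kSubsets⁻ : ∀ {k} {S : Subset m} → S ∈ kSubsets G k → ∣ S ∣ ≡ k
  ∈-kSubsets⁻ {k} S∈ = proj₂ (∈-filter⁻ (λ S → ∣ S ∣ ℕ.≟ k) {xs = allSubsets G m} S∈)

  kSubsets-empty : ∀ {k} → m ℕ.< k → kSubsets G k ≡ []
  kSubsets-empty {k} m<k = filter-none (λ S → ∣ S ∣ ℕ.≟ k) {xs = allSubsets G m} (All.tabulate too-large)
    where
    too-large : ∀ {S} → S ∈ allSubsets G m → ∣ S ∣ ≢ k
    too-large {S} _ ∣S∣≡k = ℕ.<⇒≱ m<k (subst (ℕ._≤ m) ∣S∣≡k (∣p∣≤n S))

  crosses-avoiding : ∀ {R S u w P} → Walk G u w P → u ∈ˢ R → w ∉ˢ R → ¬ Any (_∈ˢ S) P → Any (_∈ˢ cutEdges G R ─ S) P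
  crosses-avoiding []                    u∈R u∉R _      = ⊥-elim (u∉R u∈R)
  crosses-avoiding {R} (_∷_ {e = e} refl W) tail∈R w∉R avoids with head e ∈ˢ? R
  ... | yes head∈R = there (crosses-avoiding W head∈R w∉R (avoids ∘ there))
  ... | no head∉R  = here (x∈p∧x∉q⇒x∈p─q (∈-subsetOf⁺ (leaves? G R) (tail∈R , head∉R)) (avoids ∘ here))

  module _ {s t : Fin n} {y : PathVec G} (unit : IsUnitFlow G s t y) where

    unionBound : ∀ {q} {Q : Pred (List (Fin m)) q} (Q? : Decidable Q) (T : Subset m) →
                 (∀ {P} → IsPath G s t P → Q P → Any (_∈ˢ T) P) → ∑ₗ (filter Q? (paths G s t)) y ≤ fromℕ ∣ T ∣
    unionBound Q? T Q⇒hits = begin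
      ∑ₗ (filter Q? (paths G s t)) y
        ≡⟨ ∑ₗ-filter Q? (paths G s t) y ⟩
      ∑ₗ (paths G s t) (λ P → ⟦ Q? P ⟧ * y P)
        ≤⟨ ∑ₗ-mono-≤ (paths G s t) (λ {P} P∈ → let isPath = ∈paths⇒IsPath G s t P∈ in
                         *-monoʳ-≤-nonNeg (y P) {{nonNegative (proj₁ unit P isPath)}} (⟦Q⟧≤hits isPath)) ⟩
      ∑ₗ (paths G s t) (λ P → ∑[ e < m ] (⟦ e ∈ˢ? T ⟧ * ⟦ e ∈ₗ? P ⟧) * y P)
        ≡⟨ ∑ₗ-cong (paths G s t) (λ {P} _ → *-distribʳ-sum (y P) (λ e → ⟦ e ∈ˢ? T ⟧ * ⟦ e ∈ₗ? P ⟧)) ⟩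
      ∑ₗ (paths G s t) (λ P → ∑[ e < m ] (⟦ e ∈ˢ? T ⟧ * ⟦ e ∈ₗ? P ⟧ * y P))
        ≡⟨ ∑ₗ-comm-∑ (paths G s t) (λ P e → ⟦ e ∈ˢ? T ⟧ * ⟦ e ∈ₗ? P ⟧ * y P) ⟩
      ∑[ e < m ] ∑ₗ (paths G s t) (λ P → ⟦ e ∈ˢ? T ⟧ * ⟦ e ∈ₗ? P ⟧ * y P)
        ≡⟨ sum-cong-≗ (λ e → trans (∑ₗ-cong (paths G s t) (λ {P} _ → *-assoc ⟦ e ∈ˢ? T ⟧ ⟦ e ∈ₗ? P ⟧ (y P)))
                                   (trans (sym (*-distribˡ-∑ₗ ⟦ e ∈ˢ? T ⟧ (paths G s t) (λ P → ⟦ e ∈ₗ? P ⟧ * y P)))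
                                          (cong (⟦ e ∈ˢ? T ⟧ *_) (sym (load-∑ₗ G s t y e))))) ⟩
      ∑[ e < m ] (⟦ e ∈ˢ? T ⟧ * load G s t y e)
        ≤⟨ ∑-mono-≤ unit-capacity ⟩
      ∑[ e < m ] ⟦ e ∈ˢ? T ⟧
        ≡⟨ ∑-⟦∈⟧ T ⟩
      fromℕ ∣ T ∣ ∎
      where
      open ≤-Reasoning
      unit-capacity : ∀ e → ⟦ e ∈ˢ? T ⟧ * load G s t y e ≤ ⟦ e ∈ˢ? T ⟧
      unit-capacity e = subst (⟦ e ∈ˢ? T ⟧ * load G s t y e ≤_) (*-identityʳ ⟦ e ∈ˢ? T ⟧)
                              (*-monoˡ-≤-nonNeg ⟦ e ∈ˢ? T ⟧ {{nonNegative (0≤⟦⟧ (e ∈ˢ? T))}} (proj₂ unit e))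
      ⟦Q⟧≤hits : ∀ {P} → IsPath G s t P → ⟦ Q? P ⟧ ≤ ∑[ e < m ] (⟦ e ∈ˢ? T ⟧ * ⟦ e ∈ₗ? P ⟧)
      ⟦Q⟧≤hits {P} isPath with Q? P
      ... | no _   = ∑-nonNeg (λ e → *-nonNeg (0≤⟦⟧ (e ∈ˢ? T)) (0≤⟦⟧ (e ∈ₗ? P)))
      ... | yes QP = let e , e∈P , e∈T = find (Q⇒hits isPath QP) in
        ≤-trans (≤-reflexive (sym (trans (cong₂ _*_ (⟦⟧-yes (e ∈ˢ? T) e∈T) (⟦⟧-yes (e ∈ₗ? P) e∈P)) (*-identityˡ 1ℚ))))
                (∑-single (λ e → *-nonNeg (0≤⟦⟧ (e ∈ˢ? T)) (0≤⟦⟧ (e ∈ₗ? P))) e)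

    0≤val : 0ℚ ≤ val G s t y
    0≤val = ∑ₗ-nonNeg (paths G s t) (λ P∈ → proj₁ unit _ (∈paths⇒IsPath G s t P∈))

    0≤∑ₗ-filter : ∀ {q} {Q : Pred (List (Fin m)) q} (Q? : Decidable Q) → 0ℚ ≤ ∑ₗ (filter Q? (paths G s t)) y
    0≤∑ₗ-filter Q? = ∑ₗ-nonNeg (filter Q? (paths G s t))
                               (λ P∈ → proj₁ unit _ (∈paths⇒IsPath G s t (proj₁ (∈-filter⁻ Q? {xs = paths G s t} P∈))))

    val-hitValue : ∀ S → val G s t y - hitValue G s t y S ≡ ∑ₗ (filter (¬? ∘ hits? G S) (paths G s t)) y
    val-hitValue S = begin
      val G s t y - hitValue G s t y S
        ≡⟨ cong (_- hitValue G s t y S) (∑ₗ-partition (hits? G S) (paths G s t) y) ⟩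
      hitValue G s t y S + avoiding - hitValue G s t y S
        ≡⟨ solve 2 (λ h a → h :+ a :- h := a) refl (hitValue G s t y S) avoiding ⟩
      avoiding ∎
      where
      open ≡-Reasoning
      avoiding : ℚ
      avoiding = ∑ₗ (filter (¬? ∘ hits? G S) (paths G s t)) y

    hitValue≤val : ∀ S → hitValue G s t y S ≤ val G s t y
    hitValue≤val S = subst₂ _≤_ (+-identityʳ (hitValue G s t y S)) (sym (∑ₗ-partition (hits? G S) (paths G s t) y))
                                (+-monoʳ-≤ (hitValue G s t y S) (0≤∑ₗ-filter (¬? ∘ hits? G S)))

    maxHit≤val : ∀ k → maxHit G k s t y ≤ val G s t y
    maxHit≤val k = foldr-⊔-≤ (hitValue G s t y) {xs = kSubsets G k} 0≤val (λ {S} _ → hitValue≤val S)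

    maxHit≤k : ∀ k → maxHit G k s t y ≤ fromℕ k
    maxHit≤k k = foldr-⊔-≤ (hitValue G s t y) {xs = kSubsets G k} (0≤fromℕ k) λ {S} S∈ →
      subst (λ j → hitValue G s t y S ≤ fromℕ j) (∈-kSubsets⁻ S∈) (unionBound (hits? G S) S (λ _ hits → hits))

    valr≤cut : ∀ {k} R → s ∈ˢ R → t ∉ˢ R → k ℕ.≤ m → valr G k s t y ≤ fromℕ (∣ cutEdges G R ∣ ∸ k)
    valr≤cut {k} R s∈R t∉R k≤m with choose (cutEdges G R) k k≤m
    ... | S , ∣S∣≡k , ∣C─S∣ = begin
      val G s t y - maxHit G k s t y
        ≤⟨ +-monoʳ-≤ (val G s t y) (neg-antimono-≤ (≤-foldr-⊔ (hitValue G s t y) (∈-kSubsets⁺ ∣S∣≡k))) ⟩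
      val G s t y - hitValue G s t y S
        ≡⟨ val-hitValue S ⟩
      ∑ₗ (filter (¬? ∘ hits? G S) (paths G s t)) y
        ≤⟨ unionBound (¬? ∘ hits? G S) (cutEdges G R ─ S) (λ isPath → crosses-avoiding (proj₁ isPath) s∈R t∉R) ⟩
      fromℕ ∣ cutEdges G R ─ S ∣
        ≡⟨ cong fromℕ ∣C─S∣ ⟩
      fromℕ (∣ cutEdges G R ∣ ∸ k) ∎
      where open ≤-Reasoning

    cut≤valr : ∀ {k c} → val G s t y ≡ fromℕ c → fromℕ (c ∸ k) ≤ valr G k s t y
    cut≤valr {k} {c} val≡c with k ℕ.≤? c
    ... | no k≰c =
      subst (_≤ valr G k s t y) (cong fromℕ (sym (ℕ.m≤n⇒m∸n≡0 (ℕ.<⇒≤ (ℕ.≰⇒> k≰c))))) (0≤q-p (maxHit≤val k))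
    ... | yes k≤c = begin
      fromℕ (c ∸ k)                      ≡⟨ solve 2 (λ a b → a := a :+ b :- b) refl (fromℕ (c ∸ k)) (fromℕ k) ⟩
      fromℕ (c ∸ k) + fromℕ k - fromℕ k  ≡⟨ cong (_- fromℕ k) (sym (fromℕ-+ (c ∸ k) k)) ⟩
      fromℕ (c ∸ k ℕ.+ k) - fromℕ k      ≡⟨ cong (λ j → fromℕ j - fromℕ k) (ℕ.m∸n+n≡m k≤c) ⟩
      fromℕ c - fromℕ k                  ≡⟨ cong (_- fromℕ k) (sym val≡c) ⟩
      val G s t y - fromℕ k              ≤⟨ +-monoʳ-≤ (val G s t y) (neg-antimono-≤ (maxHit≤k k)) ⟩
      valr G k s t y                     ∎
      where open ≤-Reasoning

  valr≡val : ∀ {k} s t y → m ℕ.< k → valr G k s t y ≡ val G s t y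
  valr≡val {k} s t y m<k = trans (cong (λ L → val G s t y - foldr _⊔_ 0ℚ (map (hitValue G s t y) L)) (kSubsets-empty m<k))
                                     (+-identityʳ (val G s t y))

theorem7 : (G : Digraph) (s t : Fin (Digraph.n G)) (k : ℕ) (x : PathVec G) →
    IsMaxFlow G s t x → IsMaxRobustFlow G k s t x
theorem7 G s t k x max@(unit , maximal) = unit , λ y unit-y → robust y unit-y (s ≟ᶠ t) (k ℕ.≤? m)
  where
  open Digraph G
  robust : ∀ y → IsUnitFlow G s t y → Dec (s ≡ t) → Dec (k ℕ.≤ m) → valr G k s t y ≤ valr G k s t x
  robust y unit-y (yes s≡t) _ = ⊥-elim (¬maxFlow-s→s G (subst (λ t → IsMaxFlow G s t x) (sym s≡t) max))
  robust y unit-y (no _) (no k≰m) =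
    subst₂ _≤_ (sym (valr≡val G s t y (ℕ.≰⇒> k≰m))) (sym (valr≡val G s t x (ℕ.≰⇒> k≰m))) (maximal y unit-y)
  robust y unit-y (no s≢t) (yes k≤m) =
    let R , s∈R , t∉R , val≡cut = maxFlow⇒saturatedCut G max s≢t in
    ≤-trans (valr≤cut G unit-y R s∈R t∉R k≤m) (cut≤valr G unit val≡cut)
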